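{- For every $N\ge 2$, $$A(2,N)\ \ge\ \left\lceil \frac{11N^2-8N-3}{32}\right\rceil .$$
   Context: Fix integers $N\ge 2$ and $C\ge 1$ (the grooming factor). Let $\vec C_N$ be the directed cycle on vertices $0,1,\dots,N-1$ with arcs $(i,i+1 \bmod N)$. For distinct vertices $u,v$ let $d(u,v)=(v-u)\bmod N$ be the length of the directed path from $u$ to $v$ in $\vec C_N$. A request tournament $T_N$ is a tournament on $\{0,\dots,N-1\}$ containing every arc $(u,v)$ with $d(u,v)<N/2$ and, when $N$ is even, exactly one of the two arcs $(i,i+N/2)$, $(i+N/2,i)$ for each $0\le i<N/2$ (this choice being free). Each arc $(u,v)$ of $T_N$ is routed along the directed path from $u$ to $v$ in $\vec C_N$. For a subdigraph $B$ of $T_N$ and an arc $e$ of $\vec C_N$, the load $L(B,e)$ is the number of arcs of $B$ whose route contains $e$; $B$ is admissible if $L(B,e)\le C$ for every arc $e$. A valid partition is a partition of the arc set of $T_N$ into admissible subdigraphs $B_1,\dots,B_W$, where $V(B_\omega)$ is the set of endpoints of arcs of $B_\omega$; its cost is $\sum_\omega |V(B_\omega)|$. $A(C,N)$ denotes the minimum cost of a valid partition over all choices of $T_N$ and all valid partitions. -}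

module Defs where

open import Data.Nat using (ℕ; zero; suc; _+_; _*_; _∸_; _≤_; _<_; _≤ᵇ_; _<ᵇ_)
open import Data.Nat.DivMod using (_/_)
open import Data.Fin using (Fin; toℕ; _≟_)
open import Data.Bool using (Bool; true; false; _∧_; _∨_; if_then_else_)
open import Data.List using (List; allFin; map)
open import Data.Nat.ListAction using (sum)
open import Data.Bool.ListAction using (any)
open import Relation.Nullary.Decidable using (⌊_⌋)
open import Relation.Binary.PropositionalEquality using (_≡_; _≢_)

-- d(u,v) = (v - u) mod N : length of the directed path u → v in the directed cycle C_N
dist : ∀ {N} → Fin N → Fin N → ℕ
dist {N} u v with toℕ u ≤ᵇ toℕ v
... | true  = toℕ v ∸ toℕ u
... | false = N ∸ (toℕ u ∸ toℕ v)

count : ∀ {N} → (Fin N → Bool) → ℕ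
count {N} p = sum (map (λ x → if p x then 1 else 0) (allFin N))

Digraph : ℕ → Set
Digraph N = Fin N → Fin N → Bool

record IsRequestTournament (N : ℕ) (T : Digraph N) : Set where
  field
    irreflexive : ∀ u → T u u ≡ false
    short-arc   : ∀ u v → u ≢ v → 2 * dist u v < N → T u v ≡ true
    long-arc    : ∀ u v → u ≢ v → N < 2 * dist u v → T u v ≡ false
    diameter    : ∀ u v → u ≢ v → 2 * dist u v ≡ N → T u v ≢ T v u

-- A partition of the arcs of T into W subdigraphs B_0,...,B_{W-1}
-- is given by a map f assigning to each arc (u,v) of T its part f u v.
-- (Values of f on non-arcs are irrelevant.)
Assignment : ℕ → ℕ → Set
Assignment N W = Fin N → Fin N → Fin W

inPart : ∀ {N W} → Digraph N → Assignment N W → Fin W → Fin N → Fin N → Bool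
inPart T f ω u v = T u v ∧ ⌊ f u v ≟ ω ⌋

-- load L(B_ω, e_i) on the cycle arc e_i = (i, i+1): number of arcs (u,v) of B_ω
-- whose route (directed path u → v) contains e_i, i.e. d(u,i) < d(u,v)
load : ∀ {N W} → Digraph N → Assignment N W → Fin W → Fin N → ℕ
load T f ω i = sum (map (λ u → count (λ v → inPart T f ω u v ∧ (dist u i <ᵇ dist u v))) (allFin _))

Admissible : ∀ {N W} → ℕ → Digraph N → Assignment N W → Set
Admissible C T f = ∀ ω i → load T f ω i ≤ C

inVertexSet : ∀ {N W} → Digraph N → Assignment N W → Fin W → Fin N → Bool
inVertexSet {N} T f ω x = any (λ y → inPart T f ω x y ∨ inPart T f ω y x) (allFin N)

cost : ∀ {N W} → Digraph N → Assignment N W → ℕ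
cost {W = W} T f = sum (map (λ ω → count (inVertexSet T f ω)) (allFin W))

⌈_/32⌉ : ℕ → ℕ
⌈ a /32⌉ = (a + 31) / 32

module Submission where

open import Defs
open import Data.Nat using (ℕ; _+_; _*_; _∸_; _≤_)

open import Data.Nat.Base using (zero; suc; NonZero; _<_; z≤n; s≤s; _≤ᵇ_; _<ᵇ_; _≡ᵇ_; _⊓_)
open import Data.Nat.Properties hiding (_≟_; suc-injective)
open import Data.Nat.ListAction as ListAction using ()
open import Data.Nat.DivMod using (m<n*o⇒m/o<n)
open import Data.Fin.Base using (Fin; zero; suc; toℕ; fromℕ; inject₁; punchIn)
open import Data.Fin.Properties
  using (_≟_; punchInᵢ≢i; suc-injective; toℕ-injective; toℕ<n; toℕ-fromℕ; toℕ-inject₁; toℕ≤pred[n])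
open import Data.Bool.Base using (Bool; true; false; not; _∧_; _∨_; T; if_then_else_)
open import Data.Bool.Properties using (T-≡; ¬-not; ∨-zeroʳ; ∧-zeroʳ; ∧-identityʳ)
open import Data.Bool.ListAction using (any)
open import Data.List.Base using (map; tabulate; allFin)
open import Data.List.Properties using (map-tabulate)
open import Data.List.Membership.Propositional using (lose)
open import Data.List.Membership.Propositional.Properties using (∈-allFin)
open import Data.List.Relation.Unary.Any using (satisfied)
open import Data.List.Relation.Unary.Any.Properties using (any⁺; any⁻)
open import Data.Product.Base using (∃; _,_; map₂)
open import Data.Sum.Base using (inj₁; inj₂)
open import Relation.Binary.Definitions using (tri<; tri≈; tri>)
open import Relation.Nullary.Reflects using (ofʸ; ofⁿ)
open import Function.Base using (id; _∘_)
open import Function.Bundles using (Equivalence)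
open import Relation.Binary.PropositionalEquality
open import Relation.Nullary.Decidable using (⌊_⌋; yes; no; isYes≗does; dec-true; dec-false)
open import Relation.Nullary.Negation using (contradiction)
open import Data.Nat.Tactic.RingSolver using (solve-∀)
open import Algebra.Properties.Semiring.Sum +-*-semiring
  using (sum; sum-syntax; sum-cong-≗; sum-remove; sum-replicate-zero; sum-init-last; ∑-distrib-+; ∑-comm; *-distribˡ-sum)

-- Weigh every arc (u, v) of the tournament by 2N + 3 d(u, v). A part with n vertices, m ≥ 1 arcs and
-- loads summing to ℓ has ℓ ≤ 2N and m + 3 ≤ 2n, so it weighs 2Nm + 3ℓ ≤ 4Nn, and the tournament weighs
-- at most 4N · cost. On the other hand every pair {u, v} carries one arc, of weight at least
-- 2N + 3 min(d(u, v), d(v, u)), and the sum of min(k, N - k) over k < N is at least (N² - 1) / 4;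
-- comparing the two bounds gives 32 · cost ≥ 11N² - 8N - 3.
-- For m + 3 ≤ 2n call an arc (x, a) nested if a longer arc of the part leaves x. The cycle arcs leaving
-- and entering a vertex a carry at most two routes each, so outdeg a and indeg a are both at most 2 minus
-- the number of nested arcs entering a; at most one arc leaving a vertex is not nested; and
-- outdeg a + indeg a < n. Summing these over the vertices gives m + 3 ≤ 2n.

-- Iverson brackets and finite sums

⟦_⟧ : Bool → ℕ
⟦ b ⟧ = if b then 1 else 0

⟦∧⟧≡⟦⟧*⟦⟧ : ∀ b c → ⟦ b ∧ c ⟧ ≡ ⟦ b ⟧ * ⟦ c ⟧
⟦∧⟧≡⟦⟧*⟦⟧ false c = refl
⟦∧⟧≡⟦⟧*⟦⟧ true  c = sym (+-identityʳ ⟦ c ⟧)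

⟦∧⟧≤⟦⟧ : ∀ b c → ⟦ b ∧ c ⟧ ≤ ⟦ b ⟧
⟦∧⟧≤⟦⟧ false c     = z≤n
⟦∧⟧≤⟦⟧ true  false = z≤n
⟦∧⟧≤⟦⟧ true  true  = ≤-refl

⟦⟧≡⟦∧⟧+⟦∧not⟧ : ∀ b c → ⟦ b ⟧ ≡ ⟦ b ∧ c ⟧ + ⟦ b ∧ not c ⟧
⟦⟧≡⟦∧⟧+⟦∧not⟧ false c     = refl
⟦⟧≡⟦∧⟧+⟦∧not⟧ true  false = refl
⟦⟧≡⟦∧⟧+⟦∧not⟧ true  true  = refl

∧≡true⇒ˡ : ∀ {b c} → b ∧ c ≡ true → b ≡ true
∧≡true⇒ˡ {true} _ = refl

∧≡true⇒ʳ : ∀ {b c} → b ∧ c ≡ true → c ≡ true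
∧≡true⇒ʳ {true} c≡true = c≡true

contraposeᵇ : ∀ {b c} → (b ≡ true → c ≡ true) → c ≡ false → b ≡ false
contraposeᵇ {false} _   _       = refl
contraposeᵇ {true}  b⇒c c≡false = trans (sym (b⇒c refl)) c≡false

<ᵇ-true : ∀ {m n} → m < n → (m <ᵇ n) ≡ true
<ᵇ-true m<n = Equivalence.to T-≡ (<⇒<ᵇ m<n)

⟦⟧-mono : ∀ {b c} → (b ≡ true → c ≡ true) → ⟦ b ⟧ ≤ ⟦ c ⟧
⟦⟧-mono {false} _ = z≤n
⟦⟧-mono {true}  b⇒c rewrite b⇒c refl = ≤-refl

⟦⟧+⟦⟧≤ : ∀ {b c m} → (c ≡ true → b ≡ true) → (b ≡ true → 1 ≤ m) → (c ≡ true → 2 ≤ m) →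
         ⟦ b ⟧ + ⟦ c ⟧ ≤ m
⟦⟧+⟦⟧≤ {false} {false} _   _   _   = z≤n
⟦⟧+⟦⟧≤ {false} {true}  c⇒b _   _   with () ← c⇒b refl
⟦⟧+⟦⟧≤ {true}  {false} _   one _   = one refl
⟦⟧+⟦⟧≤ {true}  {true}  _   _   two = two refl

<ᵇ-sound : ∀ {m n} → (m <ᵇ n) ≡ true → m < n
<ᵇ-sound {m} {n} m<ᵇn = <ᵇ⇒< m n (Equivalence.from T-≡ m<ᵇn)

⟦⟧≤ : ∀ {b m} → (b ≡ true → 1 ≤ m) → ⟦ b ⟧ ≤ m
⟦⟧≤ {false} _     = z≤n
⟦⟧≤ {true}  1≤m   = 1≤m refl

⟦∧⟧*-select : ∀ t b c → ⟦ t ∧ b ⟧ * c ≡ (if b then ⟦ t ⟧ * c else 0)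
⟦∧⟧*-select t true  c = cong (λ x → ⟦ x ⟧ * c) (∧-identityʳ t)
⟦∧⟧*-select t false c = cong (λ x → ⟦ x ⟧ * c) (∧-zeroʳ t)

≡ᵇ-refl : ∀ k → (k ≡ᵇ k) ≡ true
≡ᵇ-refl zero    = refl
≡ᵇ-refl (suc k) = ≡ᵇ-refl k

if-≤ᵇ-yes : ∀ {a b} {x y : ℕ} → a ≤ b → (if a ≤ᵇ b then x else y) ≡ x
if-≤ᵇ-yes {a} {b} a≤b with a ≤ᵇ b | ≤ᵇ-reflects-≤ a b
... | true  | _        = refl
... | false | ofⁿ a≰b = contradiction a≤b a≰b

if-≤ᵇ-no : ∀ {a b} {x y : ℕ} → b < a → (if a ≤ᵇ b then x else y) ≡ y
if-≤ᵇ-no {a} {b} b<a with a ≤ᵇ b | ≤ᵇ-reflects-≤ a b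
... | false | _       = refl
... | true  | ofʸ a≤b = contradiction a≤b (<⇒≱ b<a)

sum-tabulate : ∀ {n} (h : Fin n → ℕ) → ListAction.sum (tabulate h) ≡ sum h
sum-tabulate {zero}  h = refl
sum-tabulate {suc n} h = cong (h zero +_) (sum-tabulate (h ∘ suc))

sum-map-allFin : ∀ {n} (h : Fin n → ℕ) → ListAction.sum (map h (allFin n)) ≡ sum h
sum-map-allFin {n} h = trans (cong ListAction.sum (map-tabulate id h)) (sum-tabulate h)

count≡∑ : ∀ {n} (p : Fin n → Bool) → count p ≡ ∑[ i < n ] ⟦ p i ⟧
count≡∑ p = sum-map-allFin (λ i → ⟦ p i ⟧)

any-allFin⁺ : ∀ {n} (p : Fin n → Bool) {i} → p i ≡ true → any p (allFin n) ≡ true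
any-allFin⁺ p {i} pi = Equivalence.to T-≡ (any⁺ p (lose (∈-allFin i) (Equivalence.from T-≡ pi)))

any-allFin⁻ : ∀ {n} (p : Fin n → Bool) → any p (allFin n) ≡ true → ∃ λ i → p i ≡ true
any-allFin⁻ p anyp = map₂ (Equivalence.to T-≡) (satisfied (any⁻ p (allFin _) (Equivalence.from T-≡ anyp)))

∑-mono-≤ : ∀ {n} {f g : Fin n → ℕ} → (∀ i → f i ≤ g i) → sum f ≤ sum g
∑-mono-≤ {zero}  f≤g = z≤n
∑-mono-≤ {suc n} f≤g = +-mono-≤ (f≤g zero) (∑-mono-≤ (f≤g ∘ suc))

∑-zero : ∀ {n} (f : Fin n → ℕ) → (∀ i → f i ≡ 0) → sum f ≡ 0
∑-zero {n} f f≡0 = trans (sum-cong-≗ f≡0) (sum-replicate-zero n)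

∑-linear : ∀ {n} a b (f g : Fin n → ℕ) → ∑[ i < n ] (a * f i + b * g i) ≡ a * sum f + b * sum g
∑-linear a b f g = trans (∑-distrib-+ (λ i → a * f i) (λ i → b * g i))
                         (sym (cong₂ _+_ (*-distribˡ-sum a f) (*-distribˡ-sum b g)))

∑-distrib-+₃ : ∀ {n} (f g h : Fin n → ℕ) → ∑[ i < n ] (f i + g i + h i) ≡ sum f + sum g + sum h
∑-distrib-+₃ f g h = trans (∑-distrib-+ (λ i → f i + g i) h) (cong (_+ sum h) (∑-distrib-+ f g))

∑-const : ∀ n c → ∑[ i < n ] c ≡ n * c
∑-const zero    c = refl
∑-const (suc n) c = cong (c +_) (∑-const n c)

term≤∑ : ∀ {n} (f : Fin n → ℕ) i → f i ≤ sum f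
term≤∑ f zero    = m≤m+n _ _
term≤∑ f (suc i) = ≤-trans (term≤∑ (f ∘ suc) i) (m≤n+m _ _)

term+term≤∑ : ∀ {n} (f : Fin n → ℕ) {i j} → i ≢ j → f i + f j ≤ sum f
term+term≤∑ f {zero}  {zero}  i≢j = contradiction refl i≢j
term+term≤∑ f {zero}  {suc j} i≢j = +-monoʳ-≤ (f zero) (term≤∑ (f ∘ suc) j)
term+term≤∑ f {suc i} {zero}  i≢j = begin
  f (suc i) + f zero  ≡⟨ +-comm (f (suc i)) (f zero) ⟩
  f zero + f (suc i)  ≤⟨ +-monoʳ-≤ (f zero) (term≤∑ (f ∘ suc) i) ⟩
  sum f               ∎
  where open ≤-Reasoning
term+term≤∑ f {suc i} {suc j} i≢j =
  ≤-trans (term+term≤∑ (f ∘ suc) (i≢j ∘ cong suc)) (m≤n+m _ (f zero))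

∑-select : ∀ {n} (x : Fin n) c → ∑[ i < n ] (if ⌊ x ≟ i ⌋ then c else 0) ≡ c
∑-select {suc n} x c = begin
  sum f                             ≡⟨ sum-remove {i = x} f ⟩
  f x + ∑[ j < n ] f (punchIn x j)  ≡⟨ cong₂ _+_ f-at-x (sum-cong-≗ (λ j → f-off-x (punchInᵢ≢i x j ∘ sym))) ⟩
  c + ∑[ j < n ] 0                  ≡⟨ cong (c +_) (sum-replicate-zero n) ⟩
  c + 0                             ≡⟨ +-identityʳ c ⟩
  c                                 ∎
  where
  open ≡-Reasoning
  f : Fin (suc n) → ℕ
  f i = if ⌊ x ≟ i ⌋ then c else 0
  f-at-x : f x ≡ c
  f-at-x = cong (if_then c else 0) (trans (isYes≗does (x ≟ x)) (dec-true (x ≟ x) refl))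
  f-off-x : ∀ {i} → x ≢ i → f i ≡ 0
  f-off-x {i} x≢i = cong (if_then c else 0) (trans (isYes≗does (x ≟ i)) (dec-false (x ≟ i) x≢i))

∑⟦⟧≤1 : ∀ {n} (p : Fin n → Bool) → (∀ i j → p i ≡ true → p j ≡ true → i ≡ j) → ∑[ i < n ] ⟦ p i ⟧ ≤ 1
∑⟦⟧≤1 {zero}  p unique = z≤n
∑⟦⟧≤1 {suc n} p unique with p zero in p0
... | false = ∑⟦⟧≤1 (p ∘ suc) (λ i j pi pj → suc-injective (unique _ _ pi pj))
... | true  = s≤s (≤-reflexive (trans (sum-cong-≗ rest) (sum-replicate-zero n)))
  where
  rest : ∀ i → ⟦ p (suc i) ⟧ ≡ 0
  rest i with p (suc i) in pi
  ... | false = refl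
  ... | true  with () ← unique _ _ p0 pi

∑⟦⟧≥1 : ∀ {n} (p : Fin n → Bool) {i} → p i ≡ true → 1 ≤ ∑[ k < n ] ⟦ p k ⟧
∑⟦⟧≥1 {n} p {i} pi = subst (λ b → ⟦ b ⟧ ≤ ∑[ k < n ] ⟦ p k ⟧) pi (term≤∑ (λ k → ⟦ p k ⟧) i)

∑⟦⟧≥2 : ∀ {n} (p : Fin n → Bool) {i j} → p i ≡ true → p j ≡ true → i ≢ j → 2 ≤ ∑[ k < n ] ⟦ p k ⟧
∑⟦⟧≥2 {n} p pi pj i≢j =
  subst₂ (λ b c → ⟦ b ⟧ + ⟦ c ⟧ ≤ ∑[ k < n ] ⟦ p k ⟧) pi pj (term+term≤∑ (λ k → ⟦ p k ⟧) i≢j)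

∑-split : ∀ a m (H : ℕ → ℕ) → ∑[ k < a + m ] H (toℕ k) ≡ ∑[ i < a ] H (toℕ i) + ∑[ j < m ] H (a + toℕ j)
∑-split zero    m H = refl
∑-split (suc a) m H = trans (cong (H 0 +_) (∑-split a m (H ∘ suc)))
                            (sym (+-assoc (H 0) (∑[ i < a ] H (suc (toℕ i))) (∑[ j < m ] H (suc a + toℕ j))))

∑-toℕ<ᵇ : ∀ n k → k ≤ n → ∑[ j < n ] ⟦ toℕ j <ᵇ k ⟧ ≡ k
∑-toℕ<ᵇ n       zero    _         = sum-replicate-zero n
∑-toℕ<ᵇ (suc n) (suc k) (s≤s k≤n) = cong suc (∑-toℕ<ᵇ n k k≤n)

∑-toℕ≡ᵇ : ∀ n k → k < n → ∑[ j < n ] ⟦ toℕ j ≡ᵇ k ⟧ ≡ 1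
∑-toℕ≡ᵇ (suc n) zero    _         = cong suc (sum-replicate-zero n)
∑-toℕ≡ᵇ (suc n) (suc k) (s≤s k<n) = ∑-toℕ≡ᵇ n k k<n

-- The directed cycle

-- Reading indices from a, the cyclic distance from a enumerates 0, 1, …, N - 1 once each.
∑-rotate : ∀ N a (G : ℕ → ℕ) → a ≤ N →
           ∑[ k < N ] G (if a ≤ᵇ toℕ k then toℕ k ∸ a else N ∸ (a ∸ toℕ k)) ≡ ∑[ k < N ] G (toℕ k)
∑-rotate N a G a≤N with m≤n⇒∃[o]m+o≡n a≤N
... | m , refl = begin
  ∑[ k < a + m ] G (d (toℕ k))                             ≡⟨ ∑-split a m (G ∘ d) ⟩
  ∑[ i < a ] G (d (toℕ i)) + ∑[ j < m ] G (d (a + toℕ j))  ≡⟨ cong₂ _+_ (sum-cong-≗ before) (sum-cong-≗ after) ⟩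
  ∑[ i < a ] G (m + toℕ i) + ∑[ j < m ] G (toℕ j)          ≡⟨ +-comm (∑[ i < a ] G (m + toℕ i)) _ ⟩
  ∑[ j < m ] G (toℕ j) + ∑[ i < a ] G (m + toℕ i)          ≡⟨ ∑-split m a G ⟨
  ∑[ k < m + a ] G (toℕ k)                                 ≡⟨ cong (λ n → ∑[ k < n ] G (toℕ k)) (+-comm m a) ⟩
  ∑[ k < a + m ] G (toℕ k)                                 ∎
  where
  open ≡-Reasoning
  d : ℕ → ℕ
  d b = if a ≤ᵇ b then b ∸ a else a + m ∸ (a ∸ b)
  before : ∀ (i : Fin a) → G (d (toℕ i)) ≡ G (m + toℕ i)
  before i = cong G (begin
    d (toℕ i)                ≡⟨ if-≤ᵇ-no (toℕ<n i) ⟩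
    a + m ∸ (a ∸ toℕ i)      ≡⟨ cong (_∸ (a ∸ toℕ i)) (+-comm a m) ⟩
    m + a ∸ (a ∸ toℕ i)      ≡⟨ +-∸-assoc m (m∸n≤m a (toℕ i)) ⟩
    m + (a ∸ (a ∸ toℕ i))    ≡⟨ cong (m +_) (m∸[m∸n]≡n (<⇒≤ (toℕ<n i))) ⟩
    m + toℕ i                ∎)
  after : ∀ (j : Fin m) → G (d (a + toℕ j)) ≡ G (toℕ j)
  after j = cong G (trans (if-≤ᵇ-yes (m≤m+n a (toℕ j))) (m+n∸m≡n a (toℕ j)))

module _ {N : ℕ} where

  dist-unfold : (u v : Fin N) → dist u v ≡ (if toℕ u ≤ᵇ toℕ v then toℕ v ∸ toℕ u else N ∸ (toℕ u ∸ toℕ v))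
  dist-unfold u v with toℕ u ≤ᵇ toℕ v
  ... | true  = refl
  ... | false = refl

  dist-≤ : {u v : Fin N} → toℕ u ≤ toℕ v → dist u v ≡ toℕ v ∸ toℕ u
  dist-≤ {u} {v} u≤v = trans (dist-unfold u v) (if-≤ᵇ-yes u≤v)

  dist-> : {u v : Fin N} → toℕ v < toℕ u → dist u v ≡ N ∸ (toℕ u ∸ toℕ v)
  dist-> {u} {v} v<u = trans (dist-unfold u v) (if-≤ᵇ-no v<u)

  dist-self : (u : Fin N) → dist u u ≡ 0
  dist-self u = trans (dist-≤ {u} {u} ≤-refl) (n∸n≡0 (toℕ u))

  dist<N : (u v : Fin N) → dist u v < N
  dist<N u v with ≤-<-connex (toℕ u) (toℕ v)
  ... | inj₁ u≤v = subst (_< N) (sym (dist-≤ u≤v)) (≤-<-trans (m∸n≤m (toℕ v) (toℕ u)) (toℕ<n v))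
  ... | inj₂ v<u = subst (_< N) (sym (dist-> v<u))
                     (∸-monoʳ-< (m<n⇒0<n∸m v<u) (≤-trans (m∸n≤m (toℕ u) (toℕ v)) (<⇒≤ (toℕ<n u))))

  dist+dist≡N-< : {u v : Fin N} → toℕ u < toℕ v → dist u v + dist v u ≡ N
  dist+dist≡N-< {u} {v} u<v = begin
    dist u v + dist v u                      ≡⟨ cong₂ _+_ (dist-≤ (<⇒≤ u<v)) (dist-> u<v) ⟩
    toℕ v ∸ toℕ u + (N ∸ (toℕ v ∸ toℕ u))    ≡⟨ m+[n∸m]≡n (≤-trans (m∸n≤m (toℕ v) (toℕ u)) (<⇒≤ (toℕ<n v))) ⟩
    N                                        ∎
    where open ≡-Reasoning

  dist+dist≡N : {u v : Fin N} → u ≢ v → dist u v + dist v u ≡ N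
  dist+dist≡N {u} {v} u≢v with <-cmp (toℕ u) (toℕ v)
  ... | tri< u<v _ _ = dist+dist≡N-< u<v
  ... | tri≈ _ u≡v _ = contradiction (toℕ-injective u≡v) u≢v
  ... | tri> _ _ v<u = trans (+-comm (dist u v) (dist v u)) (dist+dist≡N-< v<u)

  dist-pos : {u v : Fin N} → u ≢ v → 0 < dist u v
  dist-pos {u} {v} u≢v =
    +-cancelʳ-< (dist v u) 0 (dist u v) (subst (dist v u <_) (sym (dist+dist≡N u≢v)) (dist<N v u))

  ∑-dist : (u : Fin N) (G : ℕ → ℕ) → ∑[ v < N ] G (dist u v) ≡ ∑[ k < N ] G (toℕ k)
  ∑-dist u G = trans (sum-cong-≗ (cong G ∘ dist-unfold u)) (∑-rotate N (toℕ u) G (<⇒≤ (toℕ<n u)))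

  ∑-dist<ᵇ : (u : Fin N) {k : ℕ} → k ≤ N → ∑[ v < N ] ⟦ dist u v <ᵇ k ⟧ ≡ k
  ∑-dist<ᵇ u {k} k≤N = trans (∑-dist u (λ d → ⟦ d <ᵇ k ⟧)) (∑-toℕ<ᵇ N k k≤N)

  dist-injective : (u : Fin N) {v w : Fin N} → dist u v ≡ dist u w → v ≡ w
  dist-injective u {v} {w} eq with v ≟ w
  ... | yes v≡w = v≡w
  ... | no  v≢w = contradiction (∑⟦⟧≥2 atDistance (≡ᵇ-refl k) (subst (λ d → (d ≡ᵇ k) ≡ true) eq (≡ᵇ-refl k)) v≢w)
                                (<⇒≱ (≤-reflexive (cong suc unique)))
    where
    k : ℕ
    k = dist u v
    atDistance : Fin N → Bool
    atDistance x = dist u x ≡ᵇ k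
    unique : ∑[ x < N ] ⟦ atDistance x ⟧ ≡ 1
    unique = trans (∑-dist u (λ d → ⟦ d ≡ᵇ k ⟧)) (∑-toℕ≡ᵇ N k (dist<N u v))

cyclicPred : ∀ {N} → Fin N → Fin N
cyclicPred {suc n} zero    = fromℕ n
cyclicPred {suc n} (suc i) = inject₁ i

dist-cyclicPred : ∀ {N} {u a : Fin N} → u ≢ a → suc (dist u (cyclicPred a)) ≡ dist u a
dist-cyclicPred {suc n} {u} {zero} u≢0 = begin
  suc (dist u (fromℕ n))       ≡⟨ cong suc (dist-≤ u≤n) ⟩
  suc (toℕ (fromℕ n) ∸ toℕ u)  ≡⟨ cong (λ m → suc (m ∸ toℕ u)) (toℕ-fromℕ n) ⟩
  suc (n ∸ toℕ u)              ≡⟨ +-∸-assoc 1 (toℕ≤pred[n] u) ⟨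
  suc n ∸ toℕ u                ≡⟨ dist-> (n≢0⇒n>0 (u≢0 ∘ toℕ-injective)) ⟨
  dist u zero                  ∎
  where
  open ≡-Reasoning
  u≤n : toℕ u ≤ toℕ (fromℕ n)
  u≤n = subst (toℕ u ≤_) (sym (toℕ-fromℕ n)) (toℕ≤pred[n] u)
dist-cyclicPred {suc n} {u} {suc i} u≢a with ≤-<-connex (toℕ u) (toℕ i)
... | inj₁ u≤i = begin
  suc (dist u (inject₁ i))       ≡⟨ cong suc (dist-≤ (subst (toℕ u ≤_) (sym (toℕ-inject₁ i)) u≤i)) ⟩
  suc (toℕ (inject₁ i) ∸ toℕ u)  ≡⟨ cong (λ m → suc (m ∸ toℕ u)) (toℕ-inject₁ i) ⟩
  suc (toℕ i ∸ toℕ u)            ≡⟨ +-∸-assoc 1 u≤i ⟨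
  suc (toℕ i) ∸ toℕ u            ≡⟨ dist-≤ (m≤n⇒m≤1+n u≤i) ⟨
  dist u (suc i)                 ∎
  where open ≡-Reasoning
... | inj₂ i<u = begin
  suc (dist u (inject₁ i))                   ≡⟨ cong suc (dist-> (subst (_< toℕ u) (sym (toℕ-inject₁ i)) i<u)) ⟩
  suc (suc n ∸ (toℕ u ∸ toℕ (inject₁ i)))    ≡⟨ cong (λ m → suc (suc n ∸ (toℕ u ∸ m))) (toℕ-inject₁ i) ⟩
  suc (suc n ∸ (toℕ u ∸ toℕ i))              ≡⟨ cong (λ m → suc (suc n ∸ m)) (+-∸-assoc 1 i<u) ⟩
  suc (suc n ∸ suc (toℕ u ∸ suc (toℕ i)))    ≡⟨ +-∸-assoc 1 (≤-<-trans (m∸n≤m (toℕ u) (suc (toℕ i))) (toℕ<n u)) ⟨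
  suc n ∸ (toℕ u ∸ suc (toℕ i))              ≡⟨ dist-> (≤∧≢⇒< i<u (u≢a ∘ toℕ-injective ∘ sym)) ⟨
  dist u (suc i)                             ∎
  where open ≡-Reasoning

-- Request tournaments

double-sum : ∀ d d′ {N} → d + d′ ≡ N → 2 * d + 2 * d′ ≡ N + N
double-sum d d′ {N} d+d′≡N = begin
  2 * d + 2 * d′  ≡⟨ *-distribˡ-+ 2 d d′ ⟨
  2 * (d + d′)    ≡⟨ cong (2 *_) d+d′≡N ⟩
  2 * N           ≡⟨ cong (N +_) (+-identityʳ N) ⟩
  N + N           ∎
  where open ≡-Reasoning

short⇒complement-long : ∀ d d′ {N} → d + d′ ≡ N → 2 * d < N → N < 2 * d′
short⇒complement-long d d′ {N} d+d′≡N 2d<N =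
  +-cancelˡ-< (2 * d) N (2 * d′) (subst (2 * d + N <_) (sym (double-sum d d′ d+d′≡N)) (+-monoˡ-< N 2d<N))

long⇒complement-short : ∀ d d′ {N} → d + d′ ≡ N → N < 2 * d → 2 * d′ < N
long⇒complement-short d d′ {N} d+d′≡N N<2d =
  +-cancelʳ-< N (2 * d′) N (subst (2 * d′ + N <_) (trans (+-comm (2 * d′) (2 * d)) (double-sum d d′ d+d′≡N))
                                 (+-monoʳ-< (2 * d′) N<2d))

arc⇒≢ : ∀ {N} (G : Digraph N) → (∀ u → G u u ≡ false) → ∀ {u v} → G u v ≡ true → u ≢ v
arc⇒≢ G irreflexive {u} Guv refl with () ← trans (sym Guv) (irreflexive u)

module _ {N} {T : Digraph N} (isRequest : IsRequestTournament N T) where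
  open IsRequestTournament isRequest

  reverse-arc : ∀ {u v} → u ≢ v → T v u ≡ not (T u v)
  reverse-arc {u} {v} u≢v with <-cmp (2 * dist u v) N
  ... | tri< short _ _ rewrite short-arc u v u≢v short
    = long-arc v u (u≢v ∘ sym) (short⇒complement-long (dist u v) (dist v u) (dist+dist≡N u≢v) short)
  ... | tri≈ _ diam _ = ¬-not (diameter u v u≢v diam ∘ sym)
  ... | tri> _ _ long rewrite long-arc u v u≢v long
    = short-arc v u (u≢v ∘ sym) (long⇒complement-short (dist u v) (dist v u) (dist+dist≡N u≢v) long)

  arc⇒¬reverse : ∀ {u v} → T u v ≡ true → T v u ≡ false
  arc⇒¬reverse {u} {v} Tuv = trans (reverse-arc (arc⇒≢ T irreflexive Tuv)) (cong not Tuv)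

-- One part of a valid partition

m+m≤2c+1⇒m≤c : ∀ {m c} → m + m ≤ 2 * c + 1 → m ≤ c
m+m≤2c+1⇒m≤c {m} {c} m+m≤2c+1 = ≤-pred (*-cancelˡ-< 2 m (suc c) (subst₂ _≤_ (double m) (double+2 c) (s≤s m+m≤2c+1)))
  where
  double : ∀ x → 1 + (x + x) ≡ 1 + 2 * x
  double = solve-∀
  double+2 : ∀ x → 1 + (2 * x + 1) ≡ 2 * (1 + x)
  double+2 = solve-∀

m+m+m≤3c+2⇒m≤c : ∀ {m c} → m + m + m ≤ 3 * c + 2 → m ≤ c
m+m+m≤3c+2⇒m≤c {m} {c} 3m≤3c+2 = ≤-pred (*-cancelˡ-< 3 m (suc c) (subst₂ _≤_ (triple m) (triple+3 c) (s≤s 3m≤3c+2)))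
  where
  triple : ∀ x → 1 + (x + x + x) ≡ 1 + 3 * x
  triple = solve-∀
  triple+3 : ∀ x → 1 + (3 * x + 2) ≡ 3 * (1 + x)
  triple+3 = solve-∀

-- m arcs, n vertices and k nested arcs of a part; the bound m + m ≤ 3n alone suffices only for n ≥ 5.
3+m≤2n : ∀ {m n k} → 1 ≤ m → m ≤ n + k → m + k ≤ 2 * n → m + m + n ≤ n * n →
         (n ≤ 4 → m + m + k + n ≤ 4 * n) → 3 + m ≤ 2 * n
3+m≤2n {m} {0} 1≤m _ _ m+m+0≤0 _ =
  contradiction (≤-trans 1≤m (≤-trans (m≤m+n m m) (≤-trans (m≤m+n (m + m) 0) m+m+0≤0))) λ ()
3+m≤2n {m} {1} 1≤m _ _ m+m+1≤1 _ =
  contradiction (≤-trans 1≤m (≤-trans (m≤m+n m m) (+-cancelʳ-≤ 1 (m + m) 0 m+m+1≤1))) λ ()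
3+m≤2n {m} {2} _ _ _ m+m+2≤4 _ =
  +-monoʳ-≤ 3 (m+m≤2c+1⇒m≤c {c = 1} (m≤n⇒m≤1+n (+-cancelʳ-≤ 2 (m + m) 2 m+m+2≤4)))
3+m≤2n {m} {3} _ _ _ m+m+3≤9 _ =
  +-monoʳ-≤ 3 (m+m≤2c+1⇒m≤c {c = 3} (m≤n⇒m≤1+n (+-cancelʳ-≤ 3 (m + m) 6 m+m+3≤9)))
3+m≤2n {m} {4} {k} _ m≤4+k _ _ small = +-monoʳ-≤ 3 (m+m+m≤3c+2⇒m≤c {c = 5} (begin
  m + m + m          ≤⟨ +-monoʳ-≤ (m + m) m≤4+k ⟩
  m + m + (4 + k)    ≡⟨ shuffle (m + m) k ⟩
  m + m + k + 4      ≤⟨ small ≤-refl ⟩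
  16                 <⟨ n<1+n 16 ⟩
  17                 ∎))
  where
  open ≤-Reasoning
  shuffle : ∀ a b → a + (4 + b) ≡ a + b + 4
  shuffle = solve-∀
3+m≤2n {m} {suc (suc (suc (suc (suc r))))} {k} _ m≤n+k m+k≤2n _ _ = begin
  3 + m              ≤⟨ +-monoʳ-≤ 3 (m+m≤2c+1⇒m≤c {c = 7 + 2 * r} (begin
    m + m                ≤⟨ +-cancelʳ-≤ k (m + m) (3 * (5 + r)) m+m+k≤3n+k ⟩
    3 * (5 + r)          ≤⟨ m≤m+n (3 * (5 + r)) r ⟩
    3 * (5 + r) + r      ≡⟨ slack r ⟩
    2 * (7 + 2 * r) + 1  ∎)) ⟩
  3 + (7 + 2 * r)    ≡⟨ double-n r ⟩
  2 * (5 + r)        ∎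
  where
  open ≤-Reasoning
  regroup : ∀ n k → n + k + 2 * n ≡ 3 * n + k
  regroup = solve-∀
  m+m+k≤3n+k : m + m + k ≤ 3 * (5 + r) + k
  m+m+k≤3n+k = begin
    m + m + k                  ≡⟨ +-assoc m m k ⟩
    m + (m + k)                ≤⟨ +-mono-≤ m≤n+k m+k≤2n ⟩
    5 + r + k + 2 * (5 + r)    ≡⟨ regroup (5 + r) k ⟩
    3 * (5 + r) + k            ∎
  slack : ∀ r → 3 * (5 + r) + r ≡ 2 * (7 + 2 * r) + 1
  slack = solve-∀
  double-n : ∀ r → 3 + (7 + 2 * r) ≡ 2 * (5 + r)
  double-n = solve-∀

o+i+k+1≤4 : ∀ o i k → o + i + 1 ≤ 4 → o + k ≤ 2 → i + k ≤ 2 → o + i + k + 1 ≤ 4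
o+i+k+1≤4 o i zero    o+i+1≤4 _       _       = subst (λ t → t + 1 ≤ 4) (sym (+-identityʳ (o + i))) o+i+1≤4
o+i+k+1≤4 o i (suc k) _       o+k+1≤2 i+k+1≤2 =
  ≤-trans (m≤m+n (o + i + suc k + 1) k) (subst (_≤ 4) (regroup o i k) (+-mono-≤ o+k+1≤2 i+k+1≤2))
  where
  regroup : ∀ o i k → o + (1 + k) + (i + (1 + k)) ≡ o + i + (1 + k) + 1 + k
  regroup = solve-∀

2Nm+3ℓ≤4Nn : ∀ {N m n k ℓ} → m ≤ n + k → m + k ≤ 2 * n → m + m + n ≤ n * n →
              (n ≤ 4 → m + m + k + n ≤ 4 * n) → ℓ ≤ N * 2 → ℓ ≤ N * m → 2 * N * m + 3 * ℓ ≤ 4 * N * n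
2Nm+3ℓ≤4Nn {N} {zero} {n} {k} {ℓ} _ _ _ _ _ ℓ≤N*0 =
  subst (_≤ 4 * N * n) (sym (cong₂ (λ a b → a + 3 * b) (*-zeroʳ (2 * N)) ℓ≡0)) z≤n
  where
  ℓ≡0 : ℓ ≡ 0
  ℓ≡0 = n≤0⇒n≡0 (≤-trans ℓ≤N*0 (≤-reflexive (*-zeroʳ N)))
2Nm+3ℓ≤4Nn {N} {m@(suc _)} {n} {k} {ℓ} m≤n+k m+k≤2n m+m+n≤n*n small ℓ≤N*2 _ = begin
  2 * N * m + 3 * ℓ        ≤⟨ +-monoʳ-≤ (2 * N * m) (*-monoʳ-≤ 3 ℓ≤N*2) ⟩
  2 * N * m + 3 * (N * 2)  ≡⟨ factor N m ⟩
  2 * N * (3 + m)          ≤⟨ *-monoʳ-≤ (2 * N) (3+m≤2n (s≤s z≤n) m≤n+k m+k≤2n m+m+n≤n*n small) ⟩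
  2 * N * (2 * n)          ≡⟨ regroup N n ⟩
  4 * N * n                ∎
  where
  open ≤-Reasoning
  factor : ∀ N m → 2 * N * m + 3 * (N * 2) ≡ 2 * N * (3 + m)
  factor = solve-∀
  regroup : ∀ N n → 2 * N * (2 * n) ≡ 4 * N * n
  regroup = solve-∀

module Part {N : ℕ} (B : Digraph N) where

  passes : Fin N → Fin N → Fin N → Bool
  passes u v i = B u v ∧ (dist u i <ᵇ dist u v)

  tailLoad : Fin N → Fin N → ℕ
  tailLoad u i = ∑[ v < N ] ⟦ passes u v i ⟧

  arcLoad : Fin N → ℕ
  arcLoad i = ∑[ u < N ] tailLoad u i

  -- Definitionally inVertexSet T f ω when B is inPart T f ω.
  isVertex : Fin N → Bool
  isVertex x = any (λ y → B x y ∨ B y x) (allFin N)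

  order : ℕ
  order = ∑[ x < N ] ⟦ isVertex x ⟧

  outdeg indeg : Fin N → ℕ
  outdeg x = ∑[ v < N ] ⟦ B x v ⟧
  indeg  x = ∑[ u < N ] ⟦ B u x ⟧

  size : ℕ
  size = ∑[ u < N ] outdeg u

  totalLoad : ℕ
  totalLoad = ∑[ i < N ] arcLoad i

  totalLoad≡∑length : totalLoad ≡ ∑[ u < N ] ∑[ v < N ] (⟦ B u v ⟧ * dist u v)
  totalLoad≡∑length = begin
    ∑[ i < N ] ∑[ u < N ] ∑[ v < N ] ⟦ passes u v i ⟧  ≡⟨ ∑-comm (λ i u → tailLoad u i) ⟩
    ∑[ u < N ] ∑[ i < N ] ∑[ v < N ] ⟦ passes u v i ⟧  ≡⟨ sum-cong-≗ (λ u → ∑-comm (λ i v → ⟦ passes u v i ⟧)) ⟩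
    ∑[ u < N ] ∑[ v < N ] ∑[ i < N ] ⟦ passes u v i ⟧  ≡⟨ sum-cong-≗ (λ u → sum-cong-≗ (λ v → length u v)) ⟩
    ∑[ u < N ] ∑[ v < N ] (⟦ B u v ⟧ * dist u v)         ∎
    where
    open ≡-Reasoning
    length : ∀ u v → ∑[ i < N ] ⟦ passes u v i ⟧ ≡ ⟦ B u v ⟧ * dist u v
    length u v = begin
      ∑[ i < N ] ⟦ passes u v i ⟧
        ≡⟨ sum-cong-≗ (λ i → ⟦∧⟧≡⟦⟧*⟦⟧ (B u v) (dist u i <ᵇ dist u v)) ⟩
      ∑[ i < N ] (⟦ B u v ⟧ * ⟦ dist u i <ᵇ dist u v ⟧)
        ≡⟨ *-distribˡ-sum {N} ⟦ B u v ⟧ (λ i → ⟦ dist u i <ᵇ dist u v ⟧) ⟨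
      ⟦ B u v ⟧ * ∑[ i < N ] ⟦ dist u i <ᵇ dist u v ⟧
        ≡⟨ cong (⟦ B u v ⟧ *_) (∑-dist<ᵇ u (<⇒≤ (dist<N u v))) ⟩
      ⟦ B u v ⟧ * dist u v
        ∎

  ∑-weighted : ∑[ u < N ] ∑[ v < N ] (⟦ B u v ⟧ * (2 * N + 3 * dist u v)) ≡ 2 * N * size + 3 * totalLoad
  ∑-weighted = begin
    ∑[ u < N ] ∑[ v < N ] (⟦ B u v ⟧ * (2 * N + 3 * dist u v))
      ≡⟨ sum-cong-≗ (λ u → sum-cong-≗ (λ v → expand ⟦ B u v ⟧ N (dist u v))) ⟩
    ∑[ u < N ] ∑[ v < N ] (2 * N * ⟦ B u v ⟧ + 3 * (⟦ B u v ⟧ * dist u v))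
      ≡⟨ sum-cong-≗ (λ u → ∑-linear (2 * N) 3 (λ v → ⟦ B u v ⟧) (λ v → ⟦ B u v ⟧ * dist u v)) ⟩
    ∑[ u < N ] (2 * N * outdeg u + 3 * ∑[ v < N ] (⟦ B u v ⟧ * dist u v))
      ≡⟨ ∑-linear (2 * N) 3 outdeg (λ u → ∑[ v < N ] (⟦ B u v ⟧ * dist u v)) ⟩
    2 * N * size + 3 * ∑[ u < N ] ∑[ v < N ] (⟦ B u v ⟧ * dist u v)
      ≡⟨ cong (λ l → 2 * N * size + 3 * l) totalLoad≡∑length ⟨
    2 * N * size + 3 * totalLoad
      ∎
    where
    open ≡-Reasoning
    expand : ∀ b n d → b * (2 * n + 3 * d) ≡ 2 * n * b + 3 * (b * d)
    expand = solve-∀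

  tail⇒vertex : ∀ {x v} → B x v ≡ true → isVertex x ≡ true
  tail⇒vertex {x} {v} Bxv = any-allFin⁺ (λ y → B x y ∨ B y x) (cong (_∨ B v x) Bxv)

  head⇒vertex : ∀ {x v} → B v x ≡ true → isVertex x ≡ true
  head⇒vertex {x} {v} Bvx = any-allFin⁺ (λ y → B x y ∨ B y x) (trans (cong (B x v ∨_) Bvx) (∨-zeroʳ (B x v)))

  nested : Fin N → Fin N → Bool
  nested x a = B x a ∧ any (λ b → passes x b a) (allFin N)

  outermost : Fin N → Fin N → Bool
  outermost x a = B x a ∧ not (any (λ b → passes x b a) (allFin N))

  nestedIndeg nestedOutdeg : Fin N → ℕ
  nestedIndeg  a = ∑[ x < N ] ⟦ nested x a ⟧
  nestedOutdeg x = ∑[ a < N ] ⟦ nested x a ⟧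

  nestedArcs : ℕ
  nestedArcs = ∑[ x < N ] nestedOutdeg x

  nested⇒arc : ∀ {x a} → nested x a ≡ true → B x a ≡ true
  nested⇒arc = ∧≡true⇒ˡ

  nested⇒longer : ∀ {x a} → nested x a ≡ true → ∃ λ b → passes x b a ≡ true
  nested⇒longer {x} {a} nxa = any-allFin⁻ (λ b → passes x b a) (∧≡true⇒ʳ {B x a} nxa)

  passes⇒≢ : ∀ {u a b} → passes u b a ≡ true → a ≢ b
  passes⇒≢ {u} {a} passes-b refl = <-irrefl refl (<ᵇ-sound {dist u a} {dist u a} (∧≡true⇒ʳ {B u a} passes-b))

  outdeg≡nested+outermost : ∀ x → outdeg x ≡ nestedOutdeg x + ∑[ a < N ] ⟦ outermost x a ⟧
  outdeg≡nested+outermost x =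
    trans (sum-cong-≗ (λ a → ⟦⟧≡⟦∧⟧+⟦∧not⟧ (B x a) _))
          (∑-distrib-+ (λ a → ⟦ nested x a ⟧) (λ a → ⟦ outermost x a ⟧))

  longer⇒¬outermost : ∀ {x v w} → B x w ≡ true → dist x v < dist x w → outermost x v ≡ false
  longer⇒¬outermost {x} {v} {w} Bxw v<w = begin
    B x v ∧ not (any (λ b → passes x b v) (allFin N)) ≡⟨ cong (λ c → B x v ∧ not c) (any-allFin⁺ (λ b → passes x b v) passes-v) ⟩
    B x v ∧ false                                    ≡⟨ ∧-zeroʳ (B x v) ⟩
    false                                            ∎
    where
    open ≡-Reasoning
    passes-v : passes x w v ≡ true
    passes-v = trans (cong (_∧ (dist x v <ᵇ dist x w)) Bxw) (<ᵇ-true v<w)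

  outermost-unique : ∀ x v w → outermost x v ≡ true → outermost x w ≡ true → v ≡ w
  outermost-unique x v w ov ow with <-cmp (dist x v) (dist x w)
  ... | tri< v<w _ _ with () ← trans (sym ov) (longer⇒¬outermost (∧≡true⇒ˡ ow) v<w)
  ... | tri≈ _ v≈w _ = dist-injective x v≈w
  ... | tri> _ _ w<v with () ← trans (sym ow) (longer⇒¬outermost (∧≡true⇒ˡ ov) w<v)

  outdeg≤1+nestedOutdeg : ∀ x → outdeg x ≤ 1 + nestedOutdeg x
  outdeg≤1+nestedOutdeg x = begin
    outdeg x                                          ≡⟨ outdeg≡nested+outermost x ⟩
    nestedOutdeg x + ∑[ a < N ] ⟦ outermost x a ⟧
      ≤⟨ +-monoʳ-≤ (nestedOutdeg x) (∑⟦⟧≤1 (outermost x) (outermost-unique x)) ⟩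
    nestedOutdeg x + 1                                ≡⟨ +-comm (nestedOutdeg x) 1 ⟩
    1 + nestedOutdeg x                                ∎
    where open ≤-Reasoning

  nonvertex-outdeg : ∀ {x} → isVertex x ≡ false → outdeg x ≡ 0
  nonvertex-outdeg {x} x∉V = ∑-zero (λ v → ⟦ B x v ⟧) (λ v → cong ⟦_⟧ (contraposeᵇ tail⇒vertex x∉V))

  nonvertex-indeg : ∀ {x} → isVertex x ≡ false → indeg x ≡ 0
  nonvertex-indeg {x} x∉V = ∑-zero (λ u → ⟦ B u x ⟧) (λ u → cong ⟦_⟧ (contraposeᵇ head⇒vertex x∉V))

  nonvertex-nestedIndeg : ∀ {x} → isVertex x ≡ false → nestedIndeg x ≡ 0
  nonvertex-nestedIndeg {x} x∉V =
    ∑-zero (λ u → ⟦ nested u x ⟧) (λ u → cong ⟦_⟧ (contraposeᵇ (head⇒vertex ∘ nested⇒arc) x∉V))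

  ≤-atVertex : ∀ {x m} c → (isVertex x ≡ false → m ≡ 0) → (isVertex x ≡ true → m ≤ c) → m ≤ c * ⟦ isVertex x ⟧
  ≤-atVertex {x} {m} c vanish bound with isVertex x
  ... | true  = subst (m ≤_) (sym (*-identityʳ c)) (bound refl)
  ... | false = ≤-reflexive (trans (vanish refl) (sym (*-zeroʳ c)))

  ∑-atVertex : ∀ {f : Fin N → ℕ} c → (∀ x → f x ≤ c * ⟦ isVertex x ⟧) → sum f ≤ c * order
  ∑-atVertex {f} c bound = ≤-trans (∑-mono-≤ bound) (≤-reflexive (sym (*-distribˡ-sum c (λ x → ⟦ isVertex x ⟧))))

  ∑-indeg : ∑[ a < N ] indeg a ≡ size
  ∑-indeg = ∑-comm (λ a u → ⟦ B u a ⟧)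

  ∑-nestedIndeg : ∑[ a < N ] nestedIndeg a ≡ nestedArcs
  ∑-nestedIndeg = ∑-comm (λ a x → ⟦ nested x a ⟧)

  size≤order+nestedArcs : size ≤ order + nestedArcs
  size≤order+nestedArcs = ≤-trans (∑-mono-≤ outdeg≤vertex+nested) (≤-reflexive (∑-distrib-+ (λ x → ⟦ isVertex x ⟧) nestedOutdeg))
    where
    outdeg≤vertex+nested : ∀ x → outdeg x ≤ ⟦ isVertex x ⟧ + nestedOutdeg x
    outdeg≤vertex+nested x with isVertex x in x∈V
    ... | true  = outdeg≤1+nestedOutdeg x
    ... | false = subst (_≤ nestedOutdeg x) (sym (nonvertex-outdeg x∈V)) z≤n

  arcLoad≤size : ∀ i → arcLoad i ≤ size
  arcLoad≤size i = ∑-mono-≤ (λ u → ∑-mono-≤ (λ v → ⟦∧⟧≤⟦⟧ (B u v) (dist u i <ᵇ dist u v)))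

  module LoadTwo (antisym : ∀ {u v} → B u v ≡ true → B v u ≡ false) (load≤2 : ∀ i → arcLoad i ≤ 2) where

    irreflexive : ∀ u → B u u ≡ false
    irreflexive u with B u u in Buu
    ... | false = refl
    ... | true  = trans (sym Buu) (antisym Buu)

    tail-passes : ∀ {a v} → B a v ≡ true → passes a v a ≡ true
    tail-passes {a} {v} Bav = begin
      B a v ∧ (dist a a <ᵇ dist a v)  ≡⟨ cong₂ (λ b d → b ∧ (d <ᵇ dist a v)) Bav (dist-self a) ⟩
      0 <ᵇ dist a v                   ≡⟨ <ᵇ-true (dist-pos (arc⇒≢ B irreflexive Bav)) ⟩
      true                            ∎
      where open ≡-Reasoning

    head-passes : ∀ {u a} → B u a ≡ true → passes u a (cyclicPred a) ≡ true
    head-passes {u} {a} Bua =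
      trans (cong (_∧ (dist u (cyclicPred a) <ᵇ dist u a)) Bua) (<ᵇ-true (≤-reflexive (dist-cyclicPred (arc⇒≢ B irreflexive Bua))))

    longer-passes-head : ∀ {u a b} → B u a ≡ true → passes u b a ≡ true → passes u b (cyclicPred a) ≡ true
    longer-passes-head {u} {a} {b} Bua passes-a =
      trans (cong (_∧ (dist u (cyclicPred a) <ᵇ dist u b)) (∧≡true⇒ˡ passes-a))
            (<ᵇ-true (<-trans (≤-reflexive (dist-cyclicPred (arc⇒≢ B irreflexive Bua)))
                              (<ᵇ-sound {dist u a} {dist u b} (∧≡true⇒ʳ {B u b} passes-a))))

    -- The cycle arc leaving a carries every arc out of a and, for each nested arc (x, a), a longer arc out of x.
    loadAtTail : ∀ a → outdeg a + nestedIndeg a ≤ arcLoad a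
    loadAtTail a = begin
      outdeg a + nestedIndeg a
        ≡⟨ cong (_+ nestedIndeg a) (∑-select a (outdeg a)) ⟨
      ∑[ u < N ] (if ⌊ a ≟ u ⌋ then outdeg a else 0) + nestedIndeg a
        ≡⟨ ∑-distrib-+ (λ u → if ⌊ a ≟ u ⌋ then outdeg a else 0) (λ u → ⟦ nested u a ⟧) ⟨
      ∑[ u < N ] ((if ⌊ a ≟ u ⌋ then outdeg a else 0) + ⟦ nested u a ⟧)
        ≤⟨ ∑-mono-≤ perTail ⟩
      arcLoad a
        ∎
      where
      open ≤-Reasoning
      perTail : ∀ u → (if ⌊ a ≟ u ⌋ then outdeg a else 0) + ⟦ nested u a ⟧ ≤ tailLoad u a
      perTail u with a ≟ u
      ... | yes refl rewrite irreflexive a =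
        subst (_≤ tailLoad a a) (sym (+-identityʳ (outdeg a))) (∑-mono-≤ (λ v → ⟦⟧-mono (tail-passes {a} {v})))
      ... | no _ = ⟦⟧≤ (λ nua → let b , passes-b = nested⇒longer nua in ∑⟦⟧≥1 (λ v → passes u v a) passes-b)

    -- The cycle arc entering a carries every arc (u, a) and, if (u, a) is nested, a longer arc out of u.
    loadAtHead : ∀ a → indeg a + nestedIndeg a ≤ arcLoad (cyclicPred a)
    loadAtHead a = begin
      indeg a + nestedIndeg a                   ≡⟨ ∑-distrib-+ (λ u → ⟦ B u a ⟧) (λ u → ⟦ nested u a ⟧) ⟨
      ∑[ u < N ] (⟦ B u a ⟧ + ⟦ nested u a ⟧)   ≤⟨ ∑-mono-≤ perTail ⟩
      arcLoad (cyclicPred a)                    ∎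
      where
      open ≤-Reasoning
      perTail : ∀ u → ⟦ B u a ⟧ + ⟦ nested u a ⟧ ≤ tailLoad u (cyclicPred a)
      perTail u = ⟦⟧+⟦⟧≤ nested⇒arc (λ Bua → ∑⟦⟧≥1 (λ v → passes u v (cyclicPred a)) (head-passes Bua)) two
        where
        two : nested u a ≡ true → 2 ≤ tailLoad u (cyclicPred a)
        two nua with nested⇒longer nua
        ... | b , passes-b = ∑⟦⟧≥2 (λ v → passes u v (cyclicPred a))
                               (head-passes Bua) (longer-passes-head Bua passes-b) (passes⇒≢ passes-b)
          where
          Bua : B u a ≡ true
          Bua = nested⇒arc nua

    degrees≤order : ∀ a → outdeg a + indeg a + ⟦ isVertex a ⟧ ≤ order
    degrees≤order a = begin
      outdeg a + indeg a + ⟦ isVertex a ⟧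
        ≡⟨ cong (outdeg a + indeg a +_) (∑-select a ⟦ isVertex a ⟧) ⟨
      outdeg a + indeg a + ∑[ v < N ] (if ⌊ a ≟ v ⌋ then ⟦ isVertex a ⟧ else 0)
        ≡⟨ ∑-distrib-+₃ (λ v → ⟦ B a v ⟧) (λ v → ⟦ B v a ⟧) (λ v → if ⌊ a ≟ v ⌋ then ⟦ isVertex a ⟧ else 0) ⟨
      ∑[ v < N ] (⟦ B a v ⟧ + ⟦ B v a ⟧ + (if ⌊ a ≟ v ⌋ then ⟦ isVertex a ⟧ else 0))
        ≤⟨ ∑-mono-≤ perVertex ⟩
      order
        ∎
      where
      open ≤-Reasoning
      perVertex : ∀ v → ⟦ B a v ⟧ + ⟦ B v a ⟧ + (if ⌊ a ≟ v ⌋ then ⟦ isVertex a ⟧ else 0) ≤ ⟦ isVertex v ⟧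
      perVertex v with a ≟ v
      ... | yes refl rewrite irreflexive a = ≤-refl
      ... | no _ with B a v in Bav | B v a in Bva
      ...   | false | false = z≤n
      ...   | true  | true  with () ← trans (sym Bva) (antisym Bav)
      ...   | true  | false rewrite head⇒vertex Bav = ≤-refl
      ...   | false | true  rewrite tail⇒vertex Bva = ≤-refl

    size+nestedArcs≤2order : size + nestedArcs ≤ 2 * order
    size+nestedArcs≤2order = begin
      size + nestedArcs                       ≡⟨ cong (size +_) ∑-nestedIndeg ⟨
      size + ∑[ a < N ] nestedIndeg a         ≡⟨ ∑-distrib-+ outdeg nestedIndeg ⟨
      ∑[ a < N ] (outdeg a + nestedIndeg a)   ≤⟨ ∑-atVertex 2 (λ a → ≤-atVertex 2 (vanish a) (λ _ → atTail a)) ⟩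
      2 * order                               ∎
      where
      open ≤-Reasoning
      vanish : ∀ a → isVertex a ≡ false → outdeg a + nestedIndeg a ≡ 0
      vanish a a∉V = cong₂ _+_ (nonvertex-outdeg a∉V) (nonvertex-nestedIndeg a∉V)
      atTail : ∀ a → outdeg a + nestedIndeg a ≤ 2
      atTail a = ≤-trans (loadAtTail a) (load≤2 a)

    size+size+order≤order² : size + size + order ≤ order * order
    size+size+order≤order² = begin
      size + size + order                             ≡⟨ cong (λ t → size + t + order) ∑-indeg ⟨
      size + ∑[ a < N ] indeg a + order               ≡⟨ ∑-distrib-+₃ outdeg indeg (λ a → ⟦ isVertex a ⟧) ⟨
      ∑[ a < N ] (outdeg a + indeg a + ⟦ isVertex a ⟧)
        ≤⟨ ∑-atVertex order (λ a → ≤-atVertex order (vanish a) (λ _ → degrees≤order a)) ⟩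
      order * order                                   ∎
      where
      open ≤-Reasoning
      vanish : ∀ a → isVertex a ≡ false → outdeg a + indeg a + ⟦ isVertex a ⟧ ≡ 0
      vanish a a∉V = cong₂ _+_ (cong₂ _+_ (nonvertex-outdeg a∉V) (nonvertex-indeg a∉V)) (cong ⟦_⟧ a∉V)

    small-order : order ≤ 4 → size + size + nestedArcs + order ≤ 4 * order
    small-order order≤4 = begin
      size + size + nestedArcs + order
        ≡⟨ cong (λ t → size + t + nestedArcs + order) ∑-indeg ⟨
      size + ∑[ a < N ] indeg a + nestedArcs + order
        ≡⟨ cong (λ t → size + ∑[ a < N ] indeg a + t + order) ∑-nestedIndeg ⟨
      size + ∑[ a < N ] indeg a + ∑[ a < N ] nestedIndeg a + order
        ≡⟨ trans (∑-distrib-+ (λ a → outdeg a + indeg a + nestedIndeg a) (λ a → ⟦ isVertex a ⟧))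
                 (cong (_+ order) (∑-distrib-+₃ outdeg indeg nestedIndeg)) ⟨
      ∑[ a < N ] (outdeg a + indeg a + nestedIndeg a + ⟦ isVertex a ⟧)
        ≤⟨ ∑-atVertex 4 (λ a → ≤-atVertex 4 (vanish a) (bound a)) ⟩
      4 * order
        ∎
      where
      open ≤-Reasoning
      vanish : ∀ a → isVertex a ≡ false → outdeg a + indeg a + nestedIndeg a + ⟦ isVertex a ⟧ ≡ 0
      vanish a a∉V =
        cong₂ _+_ (cong₂ _+_ (cong₂ _+_ (nonvertex-outdeg a∉V) (nonvertex-indeg a∉V)) (nonvertex-nestedIndeg a∉V)) (cong ⟦_⟧ a∉V)
      bound : ∀ a → isVertex a ≡ true → outdeg a + indeg a + nestedIndeg a + ⟦ isVertex a ⟧ ≤ 4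
      bound a a∈V rewrite a∈V = o+i+k+1≤4 (outdeg a) (indeg a) (nestedIndeg a)
        (≤-trans (subst (λ b → outdeg a + indeg a + ⟦ b ⟧ ≤ order) a∈V (degrees≤order a)) order≤4)
        (≤-trans (loadAtTail a) (load≤2 a)) (≤-trans (loadAtHead a) (load≤2 (cyclicPred a)))

    totalLoad≤N*2 : totalLoad ≤ N * 2
    totalLoad≤N*2 = ≤-trans (∑-mono-≤ load≤2) (≤-reflexive (∑-const N 2))

    totalLoad≤N*size : totalLoad ≤ N * size
    totalLoad≤N*size = ≤-trans (∑-mono-≤ arcLoad≤size) (≤-reflexive (∑-const N size))

    weight≤4N·order : 2 * N * size + 3 * totalLoad ≤ 4 * N * order
    weight≤4N·order = 2Nm+3ℓ≤4Nn {N} size≤order+nestedArcs size+nestedArcs≤2order size+size+order≤order²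
                                small-order totalLoad≤N*2 totalLoad≤N*size

-- Summing over the parts

undirectedDistSum : ℕ → ℕ
undirectedDistSum N = ∑[ k < N ] (toℕ k ⊓ (N ∸ toℕ k))

undirectedDistSum-step : ∀ n → undirectedDistSum (2 + n) ≡ 1 + n + undirectedDistSum n
undirectedDistSum-step n = begin
  ∑[ k < 1 + n ] (suc (toℕ k) ⊓ (1 + n ∸ toℕ k))
    ≡⟨ sum-cong-≗ {1 + n} (λ k → cong (suc (toℕ k) ⊓_) (+-∸-assoc 1 (toℕ≤pred[n] k))) ⟩
  ∑[ k < 1 + n ] (1 + g (toℕ k))
    ≡⟨ ∑-distrib-+ {1 + n} (λ _ → 1) (g ∘ toℕ) ⟩
  ∑[ k < 1 + n ] 1 + ∑[ k < 1 + n ] g (toℕ k)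
    ≡⟨ cong₂ _+_ (trans (∑-const (1 + n) 1) (*-identityʳ (1 + n))) (sum-init-last {n} (g ∘ toℕ)) ⟩
  1 + n + (∑[ k < n ] g (toℕ (inject₁ k)) + g (toℕ (fromℕ n)))
    ≡⟨ cong (1 + n +_) (cong₂ _+_ (sum-cong-≗ {n} (cong g ∘ toℕ-inject₁)) (cong g (toℕ-fromℕ n))) ⟩
  1 + n + (undirectedDistSum n + n ⊓ (n ∸ n))           ≡⟨ cong (λ t → 1 + n + (undirectedDistSum n + n ⊓ t)) (n∸n≡0 n) ⟩
  1 + n + (undirectedDistSum n + n ⊓ 0)                 ≡⟨ cong (λ t → 1 + n + (undirectedDistSum n + t)) (⊓-zeroʳ n) ⟩
  1 + n + (undirectedDistSum n + 0)                     ≡⟨ cong (1 + n +_) (+-identityʳ (undirectedDistSum n)) ⟩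
  1 + n + undirectedDistSum n                           ∎
  where
  open ≡-Reasoning
  g : ℕ → ℕ
  g k = k ⊓ (n ∸ k)

undirectedDistSum-lower : ∀ N → N * N ≤ 4 * undirectedDistSum N + 1
undirectedDistSum-lower 0             = z≤n
undirectedDistSum-lower 1             = ≤-refl
undirectedDistSum-lower (suc (suc n)) = begin
  (2 + n) * (2 + n)                         ≡⟨ square n ⟩
  n * n + 4 * (1 + n)                       ≤⟨ +-monoˡ-≤ (4 * (1 + n)) (undirectedDistSum-lower n) ⟩
  4 * undirectedDistSum n + 1 + 4 * (1 + n) ≡⟨ regroup n (undirectedDistSum n) ⟩
  4 * (1 + n + undirectedDistSum n) + 1     ≡⟨ cong (λ t → 4 * t + 1) (undirectedDistSum-step n) ⟨
  4 * undirectedDistSum (2 + n) + 1         ∎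
  where
  open ≤-Reasoning
  square : ∀ n → (2 + n) * (2 + n) ≡ n * n + 4 * (1 + n)
  square = solve-∀
  regroup : ∀ n s → 4 * s + 1 + 4 * (1 + n) ≡ 4 * (1 + n + s) + 1
  regroup = solve-∀

11N²∸8N∸3≤32c : ∀ {N} .{{_ : NonZero N}} {c X S} → X ≤ 4 * N * c → N * (N * (2 * N) + 3 * S) ≤ X + X + N * (2 * N) →
              N * N ≤ 4 * S + 1 → 11 * N * N ∸ 8 * N ∸ 3 ≤ 32 * c
11N²∸8N∸3≤32c {N} {c} {X} {S} X≤4Nc pairing lower = begin
  11 * N * N ∸ 8 * N ∸ 3    ≡⟨ ∸-+-assoc (11 * N * N) (8 * N) 3 ⟩
  11 * N * N ∸ (8 * N + 3)  ≤⟨ m≤n+o⇒m∸n≤o (11 * N * N) (8 * N + 3) (*-cancelˡ-≤ N scaled) ⟩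
  32 * c                    ∎
  where
  open ≤-Reasoning
  expand-11 : ∀ N → N * (11 * N * N) ≡ 8 * N * N * N + 3 * N * (N * N)
  expand-11 = solve-∀
  substitute-S : ∀ N S → 8 * N * N * N + 3 * N * (4 * S + 1) ≡ 4 * (N * (N * (2 * N) + 3 * S)) + 3 * N
  substitute-S = solve-∀
  expand-X : ∀ N X → 4 * (X + X + N * (2 * N)) + 3 * N ≡ 8 * X + 8 * N * N + 3 * N
  expand-X = solve-∀
  factor-N : ∀ N c → 8 * (4 * N * c) + 8 * N * N + 3 * N ≡ N * (8 * N + 3 + 32 * c)
  factor-N = solve-∀
  scaled : N * (11 * N * N) ≤ N * (8 * N + 3 + 32 * c)
  scaled = begin
    N * (11 * N * N)                          ≡⟨ expand-11 N ⟩
    8 * N * N * N + 3 * N * (N * N)           ≤⟨ +-monoʳ-≤ (8 * N * N * N) (*-monoʳ-≤ (3 * N) lower) ⟩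
    8 * N * N * N + 3 * N * (4 * S + 1)       ≡⟨ substitute-S N S ⟩
    4 * (N * (N * (2 * N) + 3 * S)) + 3 * N   ≤⟨ +-monoˡ-≤ (3 * N) (*-monoʳ-≤ 4 pairing) ⟩
    4 * (X + X + N * (2 * N)) + 3 * N         ≡⟨ expand-X N X ⟩
    8 * X + 8 * N * N + 3 * N                 ≤⟨ +-monoˡ-≤ (3 * N) (+-monoˡ-≤ (8 * N * N) (*-monoʳ-≤ 8 X≤4Nc)) ⟩
    8 * (4 * N * c) + 8 * N * N + 3 * N       ≡⟨ factor-N N c ⟩
    N * (8 * N + 3 + 32 * c)                  ∎

⌈/32⌉-≤ : ∀ {a c} → a ≤ 32 * c → ⌈ a /32⌉ ≤ c
⌈/32⌉-≤ {a} {c} a≤32c = ≤-pred (m<n*o⇒m/o<n (begin-strict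
  a + 31          ≤⟨ +-monoˡ-≤ 31 a≤32c ⟩
  32 * c + 31     <⟨ n<1+n (32 * c + 31) ⟩
  1 + (32 * c + 31) ≡⟨ times-32 c ⟩
  (1 + c) * 32    ∎))
  where
  open ≤-Reasoning
  times-32 : ∀ c → 1 + (32 * c + 31) ≡ (1 + c) * 32
  times-32 = solve-∀

module _ {N} {T : Digraph N} (isRequest : IsRequestTournament N T) {W} (f : Assignment N W) (admissible : Admissible 2 T f) where
  open IsRequestTournament isRequest using (irreflexive)

  module P (ω : Fin W) = Part (inPart T f ω)

  load≡arcLoad : ∀ ω i → load T f ω i ≡ P.arcLoad ω i
  load≡arcLoad ω i = trans (sum-map-allFin (λ u → count (λ v → passes u v i))) (sum-cong-≗ (λ u → count≡∑ (λ v → passes u v i)))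
    where open P ω using (passes)

  cost≡∑order : cost T f ≡ ∑[ ω < W ] P.order ω
  cost≡∑order = trans (sum-map-allFin (λ ω → count (inVertexSet T f ω))) (sum-cong-≗ (λ ω → count≡∑ (inVertexSet T f ω)))

  part-antisym : ∀ ω {u v} → inPart T f ω u v ≡ true → inPart T f ω v u ≡ false
  part-antisym ω {u} {v} Buv = cong (_∧ ⌊ f v u ≟ ω ⌋) (arc⇒¬reverse isRequest (∧≡true⇒ˡ Buv))

  module L (ω : Fin W) = P.LoadTwo ω (part-antisym ω) (λ i → subst (_≤ 2) (load≡arcLoad ω i) (admissible ω i))

  ∑-parts : (w : Fin N → Fin N → ℕ) →
            ∑[ ω < W ] ∑[ u < N ] ∑[ v < N ] (⟦ inPart T f ω u v ⟧ * w u v) ≡ ∑[ u < N ] ∑[ v < N ] (⟦ T u v ⟧ * w u v)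
  ∑-parts w = begin
    ∑[ ω < W ] ∑[ u < N ] ∑[ v < N ] (⟦ inPart T f ω u v ⟧ * w u v)
      ≡⟨ ∑-comm (λ ω u → ∑[ v < N ] (⟦ inPart T f ω u v ⟧ * w u v)) ⟩
    ∑[ u < N ] ∑[ ω < W ] ∑[ v < N ] (⟦ inPart T f ω u v ⟧ * w u v)
      ≡⟨ sum-cong-≗ (λ u → ∑-comm (λ ω v → ⟦ inPart T f ω u v ⟧ * w u v)) ⟩
    ∑[ u < N ] ∑[ v < N ] ∑[ ω < W ] (⟦ inPart T f ω u v ⟧ * w u v)
      ≡⟨ sum-cong-≗ (λ u → sum-cong-≗ (λ v → onePart u v)) ⟩
    ∑[ u < N ] ∑[ v < N ] (⟦ T u v ⟧ * w u v)
      ∎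
    where
    open ≡-Reasoning
    onePart : ∀ u v → ∑[ ω < W ] (⟦ inPart T f ω u v ⟧ * w u v) ≡ ⟦ T u v ⟧ * w u v
    onePart u v = trans (sum-cong-≗ (λ ω → ⟦∧⟧*-select (T u v) ⌊ f u v ≟ ω ⌋ (w u v))) (∑-select (f u v) (⟦ T u v ⟧ * w u v))

  arcWeight : Fin N → Fin N → ℕ
  arcWeight u v = ⟦ T u v ⟧ * (2 * N + 3 * dist u v)

  totalWeight : ℕ
  totalWeight = ∑[ u < N ] ∑[ v < N ] arcWeight u v

  totalWeight≤4N·cost : totalWeight ≤ 4 * N * cost T f
  totalWeight≤4N·cost = begin
    totalWeight                                                             ≡⟨ ∑-parts (λ u v → 2 * N + 3 * dist u v) ⟨
    ∑[ ω < W ] ∑[ u < N ] ∑[ v < N ] (⟦ inPart T f ω u v ⟧ * (2 * N + 3 * dist u v))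
                                                                            ≡⟨ sum-cong-≗ P.∑-weighted ⟩
    ∑[ ω < W ] (2 * N * P.size ω + 3 * P.totalLoad ω)                       ≤⟨ ∑-mono-≤ L.weight≤4N·order ⟩
    ∑[ ω < W ] (4 * N * P.order ω)                                          ≡⟨ *-distribˡ-sum (4 * N) P.order ⟨
    4 * N * ∑[ ω < W ] P.order ω                                            ≡⟨ cong (4 * N *_) cost≡∑order ⟨
    4 * N * cost T f                                                        ∎
    where open ≤-Reasoning

  -- There is no arc on the diagonal u = v; the extra 2N there pays for the left-hand side.
  arcWeight-pair : ∀ u v → 2 * N + 3 * (dist u v ⊓ (N ∸ dist u v)) ≤ arcWeight u v + arcWeight v u + (if ⌊ u ≟ v ⌋ then 2 * N else 0)
  arcWeight-pair u v with u ≟ v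
  ... | yes refl = begin
    2 * N + 3 * (dist u u ⊓ (N ∸ dist u u))  ≡⟨ cong (λ t → 2 * N + 3 * (t ⊓ (N ∸ t))) (dist-self u) ⟩
    2 * N + 0                                ≡⟨ +-identityʳ (2 * N) ⟩
    2 * N                                    ≤⟨ m≤n+m (2 * N) (arcWeight u u + arcWeight u u) ⟩
    arcWeight u u + arcWeight u u + 2 * N    ∎
    where open ≤-Reasoning
  ... | no  u≢v = oneArc (T u v) refl
    where
    d : ℕ
    d = dist u v
    weight-arc : ∀ {x y} → T x y ≡ true → arcWeight x y ≡ 2 * N + 3 * dist x y
    weight-arc {x} {y} Txy = trans (cong (λ b → ⟦ b ⟧ * (2 * N + 3 * dist x y)) Txy) (+-identityʳ (2 * N + 3 * dist x y))
    oneArc : ∀ b → T u v ≡ b → 2 * N + 3 * (d ⊓ (N ∸ d)) ≤ arcWeight u v + arcWeight v u + 0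
    oneArc true Tuv = begin
      2 * N + 3 * (d ⊓ (N ∸ d))              ≤⟨ +-monoʳ-≤ (2 * N) (*-monoʳ-≤ 3 (m⊓n≤m d (N ∸ d))) ⟩
      2 * N + 3 * d                          ≡⟨ weight-arc Tuv ⟨
      arcWeight u v                          ≤⟨ m≤m+n (arcWeight u v) (arcWeight v u) ⟩
      arcWeight u v + arcWeight v u          ≡⟨ +-identityʳ _ ⟨
      arcWeight u v + arcWeight v u + 0      ∎
      where open ≤-Reasoning
    oneArc false Tuv = begin
      2 * N + 3 * (d ⊓ (N ∸ d))              ≤⟨ +-monoʳ-≤ (2 * N) (*-monoʳ-≤ 3 (m⊓n≤n d (N ∸ d))) ⟩
      2 * N + 3 * (N ∸ d)                    ≡⟨ cong (λ t → 2 * N + 3 * t) N∸d≡reverse ⟩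
      2 * N + 3 * dist v u                   ≡⟨ weight-arc (trans (reverse-arc isRequest u≢v) (cong not Tuv)) ⟨
      arcWeight v u                          ≤⟨ m≤n+m (arcWeight v u) (arcWeight u v) ⟩
      arcWeight u v + arcWeight v u          ≡⟨ +-identityʳ _ ⟨
      arcWeight u v + arcWeight v u + 0      ∎
      where
      open ≤-Reasoning
      N∸d≡reverse : N ∸ d ≡ dist v u
      N∸d≡reverse = trans (cong (_∸ d) (sym (dist+dist≡N u≢v))) (m+n∸m≡n d (dist v u))

  totalWeight-lower : N * (N * (2 * N) + 3 * undirectedDistSum N) ≤ totalWeight + totalWeight + N * (2 * N)
  totalWeight-lower = begin
    N * (N * (2 * N) + 3 * undirectedDistSum N)
      ≡⟨ ∑-const N (N * (2 * N) + 3 * undirectedDistSum N) ⟨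
    ∑[ u < N ] (N * (2 * N) + 3 * undirectedDistSum N)
      ≡⟨ sum-cong-≗ row ⟨
    ∑[ u < N ] ∑[ v < N ] (2 * N + 3 * (dist u v ⊓ (N ∸ dist u v)))
      ≤⟨ ∑-mono-≤ (λ u → ∑-mono-≤ (arcWeight-pair u)) ⟩
    ∑[ u < N ] ∑[ v < N ] (arcWeight u v + arcWeight v u + (if ⌊ u ≟ v ⌋ then 2 * N else 0))
      ≡⟨ sum-cong-≗ {N} (λ u → ∑-distrib-+₃ (arcWeight u) (λ v → arcWeight v u) (λ v → if ⌊ u ≟ v ⌋ then 2 * N else 0)) ⟩
    ∑[ u < N ] (∑[ v < N ] arcWeight u v + ∑[ v < N ] arcWeight v u + ∑[ v < N ] (if ⌊ u ≟ v ⌋ then 2 * N else 0))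
      ≡⟨ ∑-distrib-+₃ (λ u → ∑[ v < N ] arcWeight u v) (λ u → ∑[ v < N ] arcWeight v u)
                      (λ u → ∑[ v < N ] (if ⌊ u ≟ v ⌋ then 2 * N else 0)) ⟩
    totalWeight + ∑[ u < N ] ∑[ v < N ] arcWeight v u + ∑[ u < N ] ∑[ v < N ] (if ⌊ u ≟ v ⌋ then 2 * N else 0)
      ≡⟨ cong₂ (λ a b → totalWeight + a + b) (∑-comm (λ u v → arcWeight v u))
               (trans (sum-cong-≗ {N} (λ u → ∑-select u (2 * N))) (∑-const N (2 * N))) ⟩
    totalWeight + totalWeight + N * (2 * N)
      ∎
    where
    open ≤-Reasoning
    row : ∀ u → ∑[ v < N ] (2 * N + 3 * (dist u v ⊓ (N ∸ dist u v))) ≡ N * (2 * N) + 3 * undirectedDistSum N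
    row u = begin-equality
      ∑[ v < N ] (2 * N + 3 * (dist u v ⊓ (N ∸ dist u v)))
        ≡⟨ ∑-dist u (λ d → 2 * N + 3 * (d ⊓ (N ∸ d))) ⟩
      ∑[ k < N ] (2 * N + 3 * (toℕ k ⊓ (N ∸ toℕ k)))
        ≡⟨ ∑-distrib-+ {N} (λ _ → 2 * N) (λ k → 3 * (toℕ k ⊓ (N ∸ toℕ k))) ⟩
      ∑[ k < N ] (2 * N) + ∑[ k < N ] (3 * (toℕ k ⊓ (N ∸ toℕ k)))
        ≡⟨ cong₂ _+_ (∑-const N (2 * N)) (sym (*-distribˡ-sum {N} 3 (λ k → toℕ k ⊓ (N ∸ toℕ k)))) ⟩
      N * (2 * N) + 3 * undirectedDistSum N
        ∎

proposition4 : ∀ (N : ℕ) → 2 ≤ N →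
    ∀ (T : Digraph N) → IsRequestTournament N T →
    ∀ (W : ℕ) (f : Assignment N W) → Admissible 2 T f →
    ⌈ 11 * N * N ∸ 8 * N ∸ 3 /32⌉ ≤ cost T f
proposition4 N@(suc _) _ T isRequest W f admissible = ⌈/32⌉-≤ (11N²∸8N∸3≤32c {N} {cost T f} {S = undirectedDistSum N}
  (totalWeight≤4N·cost isRequest f admissible) (totalWeight-lower isRequest f admissible) (undirectedDistSum-lower N))
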